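{- Let $\hat{C}=(\hat{V},\hat{N},\hat{P})$ be an abstract component with layout $\mathit{C}$, and let $\hat{C}'$ be the output of the algorithm Abstract-C on $\hat{C}$ (for any choices made during its execution), regarded as an abstract component with layout $\mathit{C}$. Then $\hat{C}'$ is a valid abstraction of $\hat{C}$.
   Context: An abstract component is a directed graph $(\hat{V},\hat{N},\hat{P})$ with a layout attribute in $\{\mathit{SLL},\mathit{T},\mathit{C},\mathit{DAG}\}$; $\hat{V}$ is a finite set of variables, $\hat{N}$ a finite set of nodes, and for layout $\mathit{C}$ (cycle) $\hat{P}\subseteq(\hat{V}\times\hat{N})\cup(\hat{N}\times\hat{N})$. For $n\in\hat{N}$ let $P_{in}(\{n\})=\{(x,n)\in\hat{P}\mid x\in\hat{N}\setminus\{n\}\}$ and $P_{out}(\{n\})=\{(n,x)\in\hat{P}\mid x\in\hat{N}\setminus\{n\}\}$. A node $n$ is special if $(v,n)\in\hat{P}$ for some $v\in\hat{V}$, or $|P_{in}(\{n\})|>1$, or $|P_{out}(\{n\})|>1$; otherwise it is ordinary. Algorithm Abstract-C: (1) $M\leftarrow$ the set of ordinary nodes of $\hat{N}$; (2) while there are $a,b\in M$ with $a\neq b$ and $(a,b)\in\hat{P}$: (i) while there exists $(b,c)\in\hat{P}$: $\hat{P}\leftarrow(\hat{P}\setminus\{(b,c)\})\cup\{(a,c)\}$; (ii) $\hat{N}\leftarrow\hat{N}\setminus\{b\}$; (iii) $\hat{P}\leftarrow(\hat{P}\setminus\{(a,b)\})\cup\{(a,a)\}$; (iv) $M\leftarrow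 M\setminus\{b\}$; (3) return $(\hat{V},\hat{N},\hat{P})$. An abstract component $\hat{C}'=(\hat{V}',\hat{N}',\hat{P}')$ is a valid abstraction of $\hat{C}=(\hat{V},\hat{N},\hat{P})$ if they have the same layout, $\hat{V}'=\hat{V}$, and there are onto maps $f_N:\hat{N}\to\hat{N}'$ and $f_P:\hat{P}\to\hat{P}'$ such that: (1) for every $(v,n')\in\hat{P}'$ with $v\in\hat{V}'$, $f_P^{ -1}((v,n'))\subseteq\{(v,n)\in\hat{P}\mid n\in f_N^{ -1}(n')\}$; (2) for every $(n',m')\in\hat{P}'$ with $n',m'\in\hat{N}'$, $f_P^{ -1}((n',m'))\subseteq\{(n,m)\in\hat{P}\mid n\in f_N^{ -1}(n'),\ m\in f_N^{ -1}(m')\}$; (3) for every $(n',m',x)\in\hat{P}'$ with $x\in\{l,r\}$, $f_P^{ -1}((n',m',x))\subseteq\{(n,m,x)\in\hat{P}\mid n\in f_N^{ -1}(n'),\ m\in f_N^{ -1}(m')\}$. -}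

module Defs where

open import Data.Nat using (ℕ; _≟_)
open import Data.Bool using (Bool; true; false; _∧_; _∨_; not; T)
open import Data.Product using (Σ; ∃; ∃-syntax; _×_; _,_; proj₁; proj₂)
open import Data.Sum using (_⊎_)
open import Data.List using (List)
open import Data.List.Membership.Propositional using (_∈_)
open import Relation.Nullary using (¬_; Dec; yes; no)
open import Relation.Nullary.Decidable using (⌊_⌋)
open import Relation.Binary.PropositionalEquality using (_≡_; _≢_)

data Vertex : Set where
  var  : ℕ → Vertex
  node : ℕ → Vertex

-- An edge of P̂ is an ordered pair of vertices.  (Layout C has no l/r labels.)
Edge : Set
Edge = Vertex × Vertex

_≟ᵛ_ : (x y : Vertex) → Dec (x ≡ y)
var x  ≟ᵛ var y with x ≟ y
... | yes Relation.Binary.PropositionalEquality.refl = yes Relation.Binary.PropositionalEquality.refl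
... | no ne = no λ { Relation.Binary.PropositionalEquality.refl → ne Relation.Binary.PropositionalEquality.refl }
var x  ≟ᵛ node y = no λ ()
node x ≟ᵛ var y  = no λ ()
node x ≟ᵛ node y with x ≟ y
... | yes Relation.Binary.PropositionalEquality.refl = yes Relation.Binary.PropositionalEquality.refl
... | no ne = no λ { Relation.Binary.PropositionalEquality.refl → ne Relation.Binary.PropositionalEquality.refl }

_≟ᵉ_ : (e f : Edge) → Dec (e ≡ f)
(x , y) ≟ᵉ (x' , y') with x ≟ᵛ x' | y ≟ᵛ y'
... | yes Relation.Binary.PropositionalEquality.refl | yes Relation.Binary.PropositionalEquality.refl = yes Relation.Binary.PropositionalEquality.refl
... | no ne | _ = no λ { Relation.Binary.PropositionalEquality.refl → ne Relation.Binary.PropositionalEquality.refl }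
... | yes _ | no ne = no λ { Relation.Binary.PropositionalEquality.refl → ne Relation.Binary.PropositionalEquality.refl }

-- Finite subsets are represented by their (decidable) characteristic functions
-- together with a finiteness witness.
Finite : {A : Set} → (A → Bool) → Set
Finite {A} S = Σ (List A) λ xs → ∀ x → T (S x) → x ∈ xs

record AbsComp : Set where
  field
    V : ℕ → Bool
    N : ℕ → Bool
    P : Edge → Bool

record IsCompC (C : AbsComp) : Set where
  open AbsComp C
  field
    finV : Finite V
    finN : Finite N
    finP : Finite P
    edges : ∀ e → T (P e) →
      (∃[ v ] ∃[ n ] (e ≡ (var v , node n)) × T (V v) × T (N n)) ⊎
      (∃[ n ] ∃[ m ] (e ≡ (node n , node m)) × T (N n) × T (N m))

module _ (C : AbsComp) where
  open AbsComp C

  -- |P_in({n})| > 1 : two distinct in-edges (x,n) with x ∈ N̂ \ {n}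
  InGt1 : ℕ → Set
  InGt1 n = ∃[ x ] ∃[ y ] (x ≢ y) × (x ≢ n) × (y ≢ n) × T (N x) × T (N y)
              × T (P (node x , node n)) × T (P (node y , node n))

  OutGt1 : ℕ → Set
  OutGt1 n = ∃[ x ] ∃[ y ] (x ≢ y) × (x ≢ n) × (y ≢ n) × T (N x) × T (N y)
              × T (P (node n , node x)) × T (P (node n , node y))

  Special : ℕ → Set
  Special n = (∃[ v ] T (V v) × T (P (var v , node n))) ⊎ InGt1 n ⊎ OutGt1 n

  Ordinary : ℕ → Set
  Ordinary n = T (N n) × ¬ Special n

removeE : (Edge → Bool) → Edge → (Edge → Bool)
removeE P e x = P x ∧ not ⌊ x ≟ᵉ e ⌋

addE : (Edge → Bool) → Edge → (Edge → Bool)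
addE P e x = P x ∨ ⌊ x ≟ᵉ e ⌋

removeN : (ℕ → Bool) → ℕ → (ℕ → Bool)
removeN N b x = N x ∧ not ⌊ x ≟ b ⌋

data InnerStep (a b : ℕ) : (Edge → Bool) → (Edge → Bool) → Set where
  move : ∀ {P} c → T (P (node b , c)) →
         InnerStep a b P (addE (removeE P (node b , c)) (node a , c))

data InnerLoop (a b : ℕ) : (Edge → Bool) → (Edge → Bool) → Set where
  done : ∀ {P} → (∀ c → ¬ T (P (node b , c))) → InnerLoop a b P P
  step : ∀ {P Q R} → InnerStep a b P Q → InnerLoop a b Q R → InnerLoop a b P R

-- State of Abstract-C: current N̂, P̂ and M (V̂ never changes)
record State : Set₁ where
  constructor st
  field
    N : ℕ → Bool
    P : Edge → Bool
    M : ℕ → Set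

data OuterStep : State → State → Set₁ where
  merge : ∀ {N P M P₁} (a b : ℕ) → M a → M b → a ≢ b →
          T (P (node a , node b)) →
          InnerLoop a b P P₁ →
          OuterStep (st N P M)
                    (st (removeN N b)
                        (addE (removeE P₁ (node a , node b)) (node a , node a))
                        (λ x → M x × x ≢ b))

Halted : State → Set
Halted (st N P M) = ¬ (∃[ a ] ∃[ b ] M a × M b × a ≢ b × T (P (node a , node b)))

data OuterLoop : State → State → Set₁ where
  halt : ∀ {s} → Halted s → OuterLoop s s
  next : ∀ {s t u} → OuterStep s t → OuterLoop t u → OuterLoop s u

AbstractC : AbsComp → AbsComp → Set₁
AbstractC C C' =
  Σ (ℕ → Set) λ M' →
    OuterLoop (st (AbsComp.N C) (AbsComp.P C) (Ordinary C))
              (st (AbsComp.N C') (AbsComp.P C') M')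
    × (AbsComp.V C' ≡ AbsComp.V C)

NodeOf : AbsComp → Set
NodeOf C = Σ ℕ λ n → T (AbsComp.N C n)

EdgeOf : AbsComp → Set
EdgeOf C = Σ Edge λ e → T (AbsComp.P C e)

-- Valid abstraction (both components have layout C, so condition (3) on
-- labelled edges (n,m,x), x ∈ {l,r}, is vacuous).
record ValidAbstraction (C C' : AbsComp) : Set where
  field
    sameV : AbsComp.V C' ≡ AbsComp.V C
    fN : NodeOf C → NodeOf C'
    fP : EdgeOf C → EdgeOf C'
    fN-onto : ∀ (n' : NodeOf C') → ∃[ n ] proj₁ (fN n) ≡ proj₁ n'
    fP-onto : ∀ (e' : EdgeOf C') → ∃[ e ] proj₁ (fP e) ≡ proj₁ e'
    cond1 : ∀ (e : EdgeOf C) v n' → proj₁ (fP e) ≡ (var v , node n') →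
            ∃[ n ] Σ (T (AbsComp.N C n)) λ p →
              (proj₁ e ≡ (var v , node n)) × (proj₁ (fN (n , p)) ≡ n')
    cond2 : ∀ (e : EdgeOf C) n' m' → proj₁ (fP e) ≡ (node n' , node m') →
            ∃[ n ] ∃[ m ] Σ (T (AbsComp.N C n)) λ p → Σ (T (AbsComp.N C m)) λ q →
              (proj₁ e ≡ (node n , node m)) ×
              (proj₁ (fN (n , p)) ≡ n') × (proj₁ (fN (m , q)) ≡ m')

-- Abstract-C only ever merges an ordinary node b into a neighbour a with an
-- edge (a,b), so every intermediate component is the image of the input under
-- a renaming of nodes: the inner loop redirects the sources b ↦ a, and since
-- the only in-edge of b from another node is (a,b), replacing (a,b) by (a,a)
-- redirects the targets as well.  Renamings compose, and the final renaming
-- f yields the maps f_N and f_P of a valid abstraction.  For this to go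
-- through, the nodes still in M must stay free of variable in-edges and keep
-- at most one in-edge from another node; a merge can only add in-edges to a,
-- and these come from a itself.
module Submission where

open import Defs
open import Data.Nat using (ℕ; _≟_)
open import Data.Bool using (Bool; T)
open import Data.Bool.Properties using (T-∧; T-∨)
open import Data.Empty using (⊥-elim)
open import Data.Product using (Σ; ∃-syntax; _×_; _,_; proj₁; proj₂)
open import Data.Sum using (_⊎_; inj₁; inj₂; map₂)
open import Function using (_∘_; id; _⇔_; mk⇔; Equivalence)
open import Relation.Nullary using (¬_; yes; no)
open import Relation.Nullary.Decidable
  using (fromWitness; toWitness; fromWitnessFalse; toWitnessFalse)
open import Relation.Binary.PropositionalEquality

open Equivalence using (to; from)

∈-removeE : ∀ S e {x} → T (removeE S e x) ⇔ (T (S x) × x ≢ e)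
∈-removeE S e {x} = mk⇔
  (λ t → let s , n = to T-∧ t in s , toWitnessFalse n)
  (λ (s , n) → from T-∧ (s , fromWitnessFalse n))

∈-addE : ∀ S e {x} → T (addE S e x) ⇔ (T (S x) ⊎ x ≡ e)
∈-addE S e {x} = mk⇔
  (map₂ toWitness ∘ to T-∨)
  (from T-∨ ∘ map₂ fromWitness)

∈-removeN : ∀ N b {x} → T (removeN N b x) ⇔ (T (N x) × x ≢ b)
∈-removeN N b {x} = mk⇔
  (λ t → let s , n = to T-∧ t in s , toWitnessFalse n)
  (λ (s , n) → from T-∧ (s , fromWitnessFalse n))

_[_↦_] : ℕ → ℕ → ℕ → ℕ
x [ b ↦ a ] with x ≟ b
... | yes _ = a
... | no _  = x

↦-hit : ∀ {a} b → b [ b ↦ a ] ≡ a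
↦-hit b with b ≟ b
... | yes _    = refl
... | no b≢b = ⊥-elim (b≢b refl)

↦-miss : ∀ {a b x} → x ≢ b → x [ b ↦ a ] ≡ x
↦-miss {b = b} {x} x≢b with x ≟ b
... | yes x≡b = ⊥-elim (x≢b x≡b)
... | no _    = refl

↦-cases : ∀ {a} b x → (x ≡ b × x [ b ↦ a ] ≡ a) ⊎ (x ≢ b × x [ b ↦ a ] ≡ x)
↦-cases b x with x ≟ b
... | yes x≡b = inj₁ (x≡b , refl)
... | no x≢b  = inj₂ (x≢b , refl)

node-injective : ∀ {x y} → node x ≡ node y → x ≡ y
node-injective refl = refl

mapNode : (ℕ → ℕ) → Vertex → Vertex
mapNode f (var v)  = var v
mapNode f (node n) = node (f n)

mapSource mapTarget mapEdge : (ℕ → ℕ) → Edge → Edge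
mapSource f e = mapNode f (proj₁ e) , proj₂ e
mapTarget f e = proj₁ e , mapNode f (proj₂ e)
mapEdge   f e = mapNode f (proj₁ e) , mapNode f (proj₂ e)

mapNode-id : mapNode id ≗ id
mapNode-id (var v)  = refl
mapNode-id (node n) = refl

mapNode-∘ : ∀ g f → mapNode g ∘ mapNode f ≗ mapNode (g ∘ f)
mapNode-∘ g f (var v)  = refl
mapNode-∘ g f (node n) = refl

mapEdge-id : mapEdge id ≗ id
mapEdge-id (x , y) = cong₂ _,_ (mapNode-id x) (mapNode-id y)

mapEdge-∘ : ∀ g f → mapEdge g ∘ mapEdge f ≗ mapEdge (g ∘ f)
mapEdge-∘ g f (x , y) = cong₂ _,_ (mapNode-∘ g f x) (mapNode-∘ g f y)

mapNode-var⁻¹ : ∀ f {x v} → mapNode f x ≡ var v → x ≡ var v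
mapNode-var⁻¹ f {var _} refl = refl

mapNode-node⁻¹ : ∀ f {x n} → mapNode f x ≡ node n → ∃[ k ] x ≡ node k × f k ≡ n
mapNode-node⁻¹ f {node k} refl = k , refl , refl

mapNode-↦-miss : ∀ {a b x} → x ≢ node b → mapNode (_[ b ↦ a ]) x ≡ x
mapNode-↦-miss {x = var v}  _     = refl
mapNode-↦-miss {x = node n} x≢b = cong node (↦-miss (x≢b ∘ cong node))

record IsImage {A B : Set} (f : A → B) (S : A → Bool) (S' : B → Bool) : Set where
  field
    image-∈  : ∀ {x} → T (S x) → T (S' (f x))
    preimage : ∀ {y} → T (S' y) → ∃[ x ] T (S x) × f x ≡ y

open IsImage

IsImage-fixed : ∀ {A : Set} {S : A → Bool} {f : A → A} →
                (∀ {x} → T (S x) → f x ≡ x) → IsImage f S S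
IsImage-fixed {S = S} fixed = record
  { image-∈  = λ s → subst (T ∘ S) (sym (fixed s)) s
  ; preimage = λ {y} s → y , s , fixed s
  }

module _ {A B : Set} {S : A → Bool} {S' : B → Bool} where

  IsImage-resp : ∀ {f g : A → B} → f ≗ g → IsImage f S S' → IsImage g S S'
  IsImage-resp {f} {g} f≗g img = record
    { image-∈  = λ {x} s → subst (T ∘ S') (f≗g x) (image-∈ img s)
    ; preimage = λ s → let x , sx , fx≡y = preimage img s in
                       x , sx , trans (sym (f≗g x)) fx≡y
    }

  IsImage-∘ : ∀ {C : Set} {S'' : C → Bool} {f : A → B} {g : B → C} →
              IsImage f S S' → IsImage g S' S'' → IsImage (g ∘ f) S S''
  IsImage-∘ {g = g} img₁ img₂ = record
    { image-∈  = image-∈ img₂ ∘ image-∈ img₁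
    ; preimage = λ s → let y , sy , gy≡z = preimage img₂ s
                           x , sx , fx≡y = preimage img₁ sy
                       in x , sx , trans (cong g fx≡y) gy≡z
    }

innerStep-image : ∀ {a b P Q R} → a ≢ b → InnerStep a b P Q →
                  IsImage (mapSource (_[ b ↦ a ])) Q R →
                  IsImage (mapSource (_[ b ↦ a ])) P R
innerStep-image {a} {b} {P} {R = R} a≢b (move c bc∈P) img = record
  { image-∈ = image-∈′ ; preimage = preimage′ }
  where
  σ : Edge → Edge
  σ = mapSource (_[ b ↦ a ])

  moved-same-image : σ (node b , c) ≡ σ (node a , c)
  moved-same-image = cong (λ n → node n , c) (trans (↦-hit b) (sym (↦-miss a≢b)))

  image-∈′ : ∀ {e} → T (P e) → T (R (σ e))
  image-∈′ {e} e∈P with e ≟ᵉ (node b , c)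
  ... | yes refl = subst (T ∘ R) (sym moved-same-image) (image-∈ img (from (∈-addE (removeE P (node b , c)) (node a , c)) (inj₂ refl)))
  ... | no e≢bc  = image-∈ img (from (∈-addE (removeE P (node b , c)) (node a , c)) (inj₁ (from (∈-removeE P (node b , c)) (e∈P , e≢bc))))

  preimage′ : ∀ {y} → T (R y) → ∃[ e ] T (P e) × σ e ≡ y
  preimage′ y∈R with preimage img y∈R
  ... | e , e∈Q , σe≡y with to (∈-addE (removeE P (node b , c)) (node a , c)) e∈Q
  ...   | inj₁ e∈Q∖ac = e , proj₁ (to (∈-removeE P (node b , c)) e∈Q∖ac) , σe≡y
  ...   | inj₂ refl    = (node b , c) , bc∈P , trans moved-same-image σe≡y

innerLoop-image : ∀ {a b P P₁} → a ≢ b → InnerLoop a b P P₁ →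
                  IsImage (mapSource (_[ b ↦ a ])) P P₁
innerLoop-image a≢b (done no-out-edge) =
  IsImage-fixed λ { {x , y} xy∈P → cong (_, y) (mapNode-↦-miss λ { refl → no-out-edge y xy∈P }) }
innerLoop-image a≢b (step s loop) = innerStep-image a≢b s (innerLoop-image a≢b loop)

retarget-image : ∀ {a b S} → a ≢ b → T (S (node a , node b)) →
                 (∀ {x} → T (S (x , node b)) → x ≡ node a) →
                 IsImage (mapTarget (_[ b ↦ a ]))
                         S (addE (removeE S (node a , node b)) (node a , node a))
retarget-image {a} {b} {S} a≢b ab∈S only-from-a = record
  { image-∈ = image-∈′ ; preimage = preimage′ }
  where
  S' : Edge → Bool
  S' = addE (removeE S (node a , node b)) (node a , node a)

  τ : Edge → Edge
  τ = mapTarget (_[ b ↦ a ])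

  image-∈′ : ∀ {e} → T (S e) → T (S' (τ e))
  image-∈′ {x , y} xy∈S with y ≟ᵛ node b
  ... | yes refl rewrite only-from-a xy∈S | ↦-hit {a} b = from (∈-addE (removeE S (node a , node b)) (node a , node a)) (inj₂ refl)
  ... | no y≢b rewrite mapNode-↦-miss {a} y≢b =
        from (∈-addE (removeE S (node a , node b)) (node a , node a)) (inj₁ (from (∈-removeE S (node a , node b)) (xy∈S , y≢b ∘ cong proj₂)))

  preimage′ : ∀ {e'} → T (S' e') → ∃[ e ] T (S e) × τ e ≡ e'
  preimage′ {x , y} xy∈S' with to (∈-addE (removeE S (node a , node b)) (node a , node a)) xy∈S'
  ... | inj₂ refl = (node a , node b) , ab∈S , cong (λ n → node a , node n) (↦-hit b)
  ... | inj₁ xy∈S∖ab =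
        let xy∈S , xy≢ab = to (∈-removeE S (node a , node b)) xy∈S∖ab in
        (x , y) , xy∈S ,
        cong (x ,_) (mapNode-↦-miss λ { refl → xy≢ab (cong (_, node b) (only-from-a xy∈S)) })

removeN-image : ∀ {N a b} → T (N a) → a ≢ b → IsImage (_[ b ↦ a ]) N (removeN N b)
removeN-image {N} {a} {b} a∈N a≢b = record { image-∈ = image-∈′ ; preimage = preimage′ }
  where
  image-∈′ : ∀ {x} → T (N x) → T (removeN N b (x [ b ↦ a ]))
  image-∈′ {x} x∈N with ↦-cases {a} b x
  ... | inj₁ (_ , ρx≡a)   = subst (T ∘ removeN N b) (sym ρx≡a) (from (∈-removeN N b) (a∈N , a≢b))
  ... | inj₂ (x≢b , ρx≡x) = subst (T ∘ removeN N b) (sym ρx≡x) (from (∈-removeN N b) (x∈N , x≢b))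

  preimage′ : ∀ {y} → T (removeN N b y) → ∃[ x ] T (N x) × x [ b ↦ a ] ≡ y
  preimage′ {y} y∈N∖b = let y∈N , y≢b = to (∈-removeN N b) y∈N∖b in y , y∈N , ↦-miss y≢b

record Absorbable (N : ℕ → Bool) (P : Edge → Bool) (m : ℕ) : Set where
  field
    present   : T (N m)
    no-var-in : ∀ v → ¬ T (P (var v , node m))
    unique-in : ∀ {x y} → x ≢ m → y ≢ m →
                T (P (node x , node m)) → T (P (node y , node m)) → x ≡ y

module Merge {N : ℕ → Bool} {P : Edge → Bool} {a b : ℕ} (a≢b : a ≢ b)
             (ab∈P : T (P (node a , node b))) (b-absorbable : Absorbable N P b) where

  private
    module B = Absorbable b-absorbable

  ρ : ℕ → ℕ
  ρ = _[ b ↦ a ]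

  in-b-renamed : ∀ {x} → T (P (x , node b)) → mapNode ρ x ≡ node a
  in-b-renamed {var v}  vb∈P = ⊥-elim (B.no-var-in v vb∈P)
  in-b-renamed {node x} xb∈P with ↦-cases {a} b x
  ... | inj₁ (_ , ρx≡a)   = cong node ρx≡a
  ... | inj₂ (x≢b , ρx≡x) = cong node (trans ρx≡x (B.unique-in x≢b a≢b xb∈P ab∈P))

  merge-edge-image : ∀ {P₁} → InnerLoop a b P P₁ →
                     IsImage (mapEdge ρ) P (addE (removeE P₁ (node a , node b)) (node a , node a))
  merge-edge-image {P₁} loop = IsImage-∘ sources (retarget-image a≢b ab∈P₁ only-a-into-b)
    where
    sources : IsImage (mapSource ρ) P P₁
    sources = innerLoop-image a≢b loop

    ab∈P₁ : T (P₁ (node a , node b))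
    ab∈P₁ = subst (λ n → T (P₁ (node n , node b))) (↦-miss a≢b) (image-∈ sources ab∈P)

    only-a-into-b : ∀ {x} → T (P₁ (x , node b)) → x ≡ node a
    only-a-into-b xb∈P₁ with preimage sources xb∈P₁
    ... | (x₀ , _) , x₀b∈P , refl = in-b-renamed x₀b∈P

  module _ {P' : Edge → Bool} (image : IsImage (mapEdge ρ) P P') {m : ℕ} (m≢b : m ≢ b)
           (m-absorbable : Absorbable N P m) where

    private
      module M = Absorbable m-absorbable

    no-var-into-image : ∀ v → ¬ T (P' (var v , node m))
    no-var-into-image v vm∈P' with preimage image vm∈P'
    ... | (x₀ , y₀) , e∈P , eq
        with mapNode-var⁻¹ ρ (cong proj₁ eq) | mapNode-node⁻¹ ρ (cong proj₂ eq)
    ... | refl | k , refl , ρk≡m with ↦-cases {a} b k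
    ...   | inj₁ (refl , _)   = B.no-var-in v e∈P
    ...   | inj₂ (_ , ρk≡k) rewrite trans (sym ρk≡k) ρk≡m = M.no-var-in v e∈P

    -- In-edges of b are renamed to the self-loop (a,a), so x₀ points to m itself.
    node-into-image : ∀ {x} → x ≢ m → T (P' (node x , node m)) →
                      ∃[ x₀ ] x₀ ≢ m × T (P (node x₀ , node m)) × ρ x₀ ≡ x
    node-into-image {x} x≢m xm∈P' with preimage image xm∈P'
    ... | (x₀ , y₀) , e∈P , eq
        with mapNode-node⁻¹ ρ (cong proj₁ eq) | mapNode-node⁻¹ ρ (cong proj₂ eq)
    ... | k , refl , ρk≡x | l , refl , ρl≡m with ↦-cases {a} b l
    ...   | inj₁ (refl , ρb≡a) =
            ⊥-elim (x≢m (begin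
              x   ≡⟨ ρk≡x ⟨
              ρ k ≡⟨ node-injective (in-b-renamed e∈P) ⟩
              a   ≡⟨ ρb≡a ⟨
              ρ b ≡⟨ ρl≡m ⟩
              m   ∎))
      where open ≡-Reasoning
    ...   | inj₂ (_ , ρl≡l) rewrite trans (sym ρl≡l) ρl≡m =
            k , (λ { refl → x≢m (trans (sym ρk≡x) (↦-miss m≢b)) }) , e∈P , ρk≡x

    absorbable-image : Absorbable (removeN N b) P' m
    absorbable-image = record
      { present   = from (∈-removeN N b) (M.present , m≢b)
      ; no-var-in = no-var-into-image
      ; unique-in = λ x≢m y≢m xm∈P' ym∈P' →
          let x₀ , x₀≢m , x₀m∈P , ρx₀≡x = node-into-image x≢m xm∈P'
              y₀ , y₀≢m , y₀m∈P , ρy₀≡y = node-into-image y≢m ym∈P'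
          in trans (sym ρx₀≡x) (trans (cong ρ (M.unique-in x₀≢m y₀≢m x₀m∈P y₀m∈P)) ρy₀≡y)
      }

record RenamingOf (N₀ : ℕ → Bool) (P₀ : Edge → Bool) (N : ℕ → Bool) (P : Edge → Bool) : Set where
  field
    rename     : ℕ → ℕ
    node-image : IsImage rename N₀ N
    edge-image : IsImage (mapEdge rename) P₀ P

RenamingOf-refl : ∀ {N P} → RenamingOf N P N P
RenamingOf-refl = record
  { rename     = id
  ; node-image = IsImage-fixed λ _ → refl
  ; edge-image = IsImage-fixed λ {e} _ → mapEdge-id e
  }

RenamingOf-trans : ∀ {N₀ P₀ N₁ P₁ N₂ P₂} →
                   RenamingOf N₀ P₀ N₁ P₁ → RenamingOf N₁ P₁ N₂ P₂ → RenamingOf N₀ P₀ N₂ P₂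
RenamingOf-trans r₁ r₂ = record
  { rename     = R₂.rename ∘ R₁.rename
  ; node-image = IsImage-∘ R₁.node-image R₂.node-image
  ; edge-image = IsImage-resp (mapEdge-∘ R₂.rename R₁.rename) (IsImage-∘ R₁.edge-image R₂.edge-image)
  }
  where
  module R₁ = RenamingOf r₁
  module R₂ = RenamingOf r₂

StateRenaming : State → State → Set
StateRenaming (st N P _) (st N' P' _) = RenamingOf N P N' P'

AllAbsorbable : State → Set
AllAbsorbable (st N P M) = ∀ {m} → M m → Absorbable N P m

outerStep-renaming : ∀ {s t} → OuterStep s t → AllAbsorbable s →
                     StateRenaming s t × AllAbsorbable t
outerStep-renaming (merge a b a∈M b∈M a≢b ab∈P loop) absorbable =
  record { rename     = ρ
         ; node-image = removeN-image (Absorbable.present (absorbable a∈M)) a≢b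
         ; edge-image = merge-edge-image loop } ,
  λ (m∈M , m≢b) → absorbable-image (merge-edge-image loop) m≢b (absorbable m∈M)
  where open Merge a≢b ab∈P (absorbable b∈M)

outerLoop-renaming : ∀ {s t} → OuterLoop s t → AllAbsorbable s → StateRenaming s t
outerLoop-renaming (halt _)          _          = RenamingOf-refl
outerLoop-renaming (next first rest) absorbable =
  let r , absorbable′ = outerStep-renaming first absorbable
  in RenamingOf-trans r (outerLoop-renaming rest absorbable′)

module _ {C : AbsComp} (wf : IsCompC C) where
  open AbsComp C
  open IsCompC wf

  var-source-in-V : ∀ {v y} → T (P (var v , y)) → T (V v)
  var-source-in-V vy∈P with edges _ vy∈P
  ... | inj₁ (_ , _ , refl , v∈V , _) = v∈V

  node-source-in-N : ∀ {n y} → T (P (node n , y)) → T (N n)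
  node-source-in-N ny∈P with edges _ ny∈P
  ... | inj₂ (_ , _ , refl , n∈N , _) = n∈N

  node-target-in-N : ∀ {x n} → T (P (x , node n)) → T (N n)
  node-target-in-N xn∈P with edges _ xn∈P
  ... | inj₁ (_ , _ , refl , _ , n∈N) = n∈N
  ... | inj₂ (_ , _ , refl , _ , n∈N) = n∈N

  ordinary-absorbable : ∀ {m} → Ordinary C m → Absorbable N P m
  ordinary-absorbable {m} (m∈N , not-special) = record
    { present   = m∈N
    ; no-var-in = λ v vm∈P → not-special (inj₁ (v , var-source-in-V vm∈P , vm∈P))
    ; unique-in = unique-in
    }
    where
    unique-in : ∀ {x y} → x ≢ m → y ≢ m →
                T (P (node x , node m)) → T (P (node y , node m)) → x ≡ y
    unique-in {x} {y} x≢m y≢m xm∈P ym∈P with x ≟ y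
    ... | yes x≡y = x≡y
    ... | no x≢y  = ⊥-elim (not-special (inj₂ (inj₁
          (x , y , x≢y , x≢m , y≢m , node-source-in-N xm∈P , node-source-in-N ym∈P , xm∈P , ym∈P))))

  renaming-valid : ∀ {C'} → AbsComp.V C' ≡ V →
                   RenamingOf N P (AbsComp.N C') (AbsComp.P C') → ValidAbstraction C C'
  renaming-valid sameV r = record
    { sameV   = sameV
    ; fN      = λ (n , n∈N) → f n , image-∈ node-image n∈N
    ; fP      = λ (e , e∈P) → mapEdge f e , image-∈ edge-image e∈P
    ; fN-onto = λ (n' , n'∈N') → let n , n∈N , fn≡n' = preimage node-image n'∈N' in (n , n∈N) , fn≡n'
    ; fP-onto = λ (e' , e'∈P') → let e , e∈P , fe≡e' = preimage edge-image e'∈P' in (e , e∈P) , fe≡e'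
    ; cond1   = cond1
    ; cond2   = cond2
    }
    where
    open RenamingOf r renaming (rename to f)

    cond1 : ∀ (e : EdgeOf C) v n' → mapEdge f (proj₁ e) ≡ (var v , node n') →
            ∃[ n ] Σ (T (N n)) λ n∈N → (proj₁ e ≡ (var v , node n)) × (f n ≡ n')
    cond1 ((x , y) , e∈P) v n' eq
      with mapNode-var⁻¹ f (cong proj₁ eq) | mapNode-node⁻¹ f (cong proj₂ eq)
    ... | refl | n , refl , fn≡n' = n , node-target-in-N e∈P , refl , fn≡n'

    cond2 : ∀ (e : EdgeOf C) n' m' → mapEdge f (proj₁ e) ≡ (node n' , node m') →
            ∃[ n ] ∃[ m ] Σ (T (N n)) λ n∈N → Σ (T (N m)) λ m∈N →
              (proj₁ e ≡ (node n , node m)) × (f n ≡ n') × (f m ≡ m')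
    cond2 ((x , y) , e∈P) n' m' eq
      with mapNode-node⁻¹ f (cong proj₁ eq) | mapNode-node⁻¹ f (cong proj₂ eq)
    ... | n , refl , fn≡n' | m , refl , fm≡m' =
          n , m , node-source-in-N e∈P , node-target-in-N e∈P , refl , fn≡n' , fm≡m'

theorem6 : (C C' : AbsComp) → IsCompC C → AbstractC C C' → ValidAbstraction C C'
theorem6 C C' wf (_ , run , sameV) =
  renaming-valid wf sameV (outerLoop-renaming run (ordinary-absorbable wf))
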